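{- Let $M=(E,\rho)$ be a matroid of rank $d\ge1$ with $\#E=m$ and with $\ell$ loops. Then $W_{d-1}^M(p)=(1+p)^{m-\ell}-1$.
   Context: For $0\le i\le d-1$, let $\mathcal{S}_i^M=\{S\subseteq E:\rho(S)\ge d-i\}$ ordered by inclusion, $\mathcal{L}_i^M=\{\hat0\}\oplus\mathcal{S}_i^M$ (new minimum adjoined), $\mu_i^M(S)$ the Möbius function $\mu(\hat0,S)$ of $\mathcal{L}_i^M$, and $W_i^M(p):=\sum_{S\in\mathcal{S}_i^M}\mu_i^M(S)(-p)^{\#S-d+1+i}$. -}

module Defs where

open import Data.Nat as ℕ using (ℕ; zero; suc; _≤_; _∸_; _<ᵇ_; _≤ᵇ_)
open import Data.Bool using (Bool; true; false; _∧_; if_then_else_)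
open import Data.Integer as ℤ using (ℤ; +_)
open import Data.List using (List; []; _∷_; map; foldr; _++_; filterᵇ; length)
open import Data.Vec using (Vec; []; _∷_)
open import Data.Fin using (Fin)
open import Data.Fin.Subset using (Subset; ⊤; ⁅_⁆; _⊆_; _∪_; _∩_; ∣_∣)
open import Data.Fin.Subset.Properties using (_⊆?_)
open import Relation.Nullary using (does)
open import Data.List using (allFin) renaming (sum to sumℕ)

record Matroid (m : ℕ) : Set where
  field
    ρ        : Subset m → ℕ
    ρ-bound  : ∀ S → ρ S ≤ ∣ S ∣
    ρ-mono   : ∀ {S T} → S ⊆ T → ρ S ≤ ρ T
    ρ-submod : ∀ S T → ρ (S ∪ T) ℕ.+ ρ (S ∩ T) ≤ ρ S ℕ.+ ρ T

open Matroid public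

rank : ∀ {m} → Matroid m → ℕ
rank M = ρ M ⊤

loops : ∀ {m} → Matroid m → ℕ
loops {m} M = length (filterᵇ (λ e → ρ M ⁅ e ⁆ ℕ.≡ᵇ 0) (allFin m))

allSubsets : (n : ℕ) → List (Subset n)
allSubsets zero = [] ∷ []
allSubsets (suc n) = map (true ∷_) (allSubsets n) ++ map (false ∷_) (allSubsets n)

sumℤ : List ℤ → ℤ
sumℤ = foldr ℤ._+_ (+ 0)

inS : ∀ {m} → Matroid m → ℕ → Subset m → Bool
inS M i S = (rank M ∸ i) ≤ᵇ ρ M S

properSub : ∀ {m} → Subset m → Subset m → Bool
properSub T S = does (T ⊆? S) ∧ (∣ T ∣ <ᵇ ∣ S ∣)

-- Möbius function μ(0̂, S) in L_i^M = {0̂} ⊕ S_i^M, by the defining recursion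
--   μ(0̂,0̂) = 1,  μ(0̂,S) = - Σ_{0̂ ≤ T < S} μ(0̂,T) = -(1 + Σ_{T ∈ S_i, T ⊊ S} μ(0̂,T)).
-- The first argument is fuel; it is correct whenever fuel > ∣ S ∣.
mobiusF : ∀ {m} → Matroid m → ℕ → ℕ → Subset m → ℤ
mobiusF M i zero S = + 0
mobiusF {m} M i (suc k) S =
  ℤ.- ((+ 1) ℤ.+ sumℤ (map (mobiusF M i k)
          (filterᵇ (λ T → inS M i T ∧ properSub T S) (allSubsets m))))

mobius : ∀ {m} → Matroid m → ℕ → Subset m → ℤ
mobius {m} M i S = mobiusF M i (suc m) S

W : ∀ {m} → Matroid m → ℕ → ℤ → ℤ
W {m} M i p = sumℤ (map (λ S → mobius M i S ℤ.* ((ℤ.- p) ℤ.^ ((∣ S ∣ ℕ.+ 1 ℕ.+ i) ∸ rank M)))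
                        (filterᵇ (inS M i) (allSubsets m)))

-- For i = d − 1 the sets of 𝒮ᵢ are those of positive rank, i.e. those meeting the set N of
-- non-loops (a set of loops has rank 0 by submodularity). On {0̂} ⊕ {S : S ∩ N ≠ ∅} the Möbius
-- function is μ(S) = (−1)^#S for S ⊆ N and 0 otherwise. Indeed, for S meeting N the recursion
-- sums this candidate over the T ⊊ S meeting N; as the candidate vanishes on the nonempty sets
-- disjoint from N, that is the binomial sum Σ_{T ⊆ S ∩ N} (−1)^#T = 0 minus the terms T = S and
-- T = ∅, i.e. −μ(S) − 1, as the recursion requires. The exponent #S − d + 1 + i equals #S, so
-- W(p) = Σ_{∅ ≠ S ⊆ N} p^#S = (1 + p)^#N − 1, and #N = m − ℓ.
module Submission where

open import Defs
open import Data.Nat using (ℕ; _≤_; _∸_)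
open import Data.Integer using (ℤ; +_; _+_; _-_; _^_)
open import Relation.Binary.PropositionalEquality using (_≡_)

open import Data.Bool using (Bool; true; false; _∧_; if_then_else_)
import Data.Bool as Bool
open import Data.Bool.Properties using (if-∧; T-≡)
open import Data.Empty using (⊥-elim)
open import Data.Fin using (Fin)
import Data.Fin as Fin
open import Data.Fin.Subset
  using (Subset; inside; outside; ∣_∣; _∈_; _⊆_; _⊂_; _∩_; _∪_; _─_; ∁; ⊥; ⁅_⁆; Nonempty; Empty)
open import Data.Fin.Subset.Properties
  using ( _⊆?_; _∈?_; nonempty?; ⊆-refl; ⊆-min; drop-∷-⊆; p⊆q⇒∣p∣≤∣q∣; Empty-unique; ∉⊥
        ; x∈p∩q⁺; x∈p∩q⁻; p∩q⊆p; p∩q⊆q; x∈p∪q⁺; x∈⁅x⁆; x∈⁅y⁆⇒x≡y; x∈p∧x≢y⇒x∈p-y; p─q⊆p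
        ; x∈p⇒p-x⊂p; x∉p⇒x∈∁p; x∈∁p⇒x∉p; ∣⊥∣≡0; ∣⁅x⁆∣≡1; ∣p∣≤n; ∣∁p∣≡n∸∣p∣)
open import Data.Fin.Subset.Induction using (⊂-wellFounded; Acc; acc)
open import Data.Integer using (0ℤ; 1ℤ; -1ℤ; -_; _*_)
import Data.Integer.Properties as ℤ
open import Data.Integer.Solver using (module +-*-Solver)
open import Data.List using (List; []; _∷_; map; filterᵇ; _++_; length)
import Data.List as List
import Data.List.Properties as List
import Data.Nat as ℕ
open import Data.Nat using (zero; suc; _<_; _<ᵇ_; s≤s)
import Data.Nat.Properties as ℕ
open import Data.Product using (_×_; _,_; proj₁)
open import Data.Sum using (inj₁; inj₂)
open import Data.Vec using ([]; _∷_; here; tabulate)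
import Data.Vec.Properties as Vec
open import Function using (_∘_)
open import Function.Bundles using (_⇔_; mk⇔; module Equivalence)
open import Relation.Binary.Definitions using (DecidableEquality)
open import Relation.Binary.PropositionalEquality
  using (_≢_; refl; sym; trans; cong; cong₂; subst; ≢-sym; module ≡-Reasoning)
open import Relation.Nullary using (¬_; does; yes; no; ofʸ; ofⁿ; contradiction)
open import Relation.Nullary.Decidable using (does-⇔; dec-true; dec-false; _×-dec_)

open +-*-Solver using (solve; _:=_; _:+_; _:-_; _:*_; :-_; con)

private
  variable
    A B : Set
    n : ℕ

∑ : List A → (A → ℤ) → ℤ
∑ xs f = sumℤ (map f xs)

∑-++ : ∀ xs ys (f : A → ℤ) → ∑ (xs ++ ys) f ≡ ∑ xs f + ∑ ys f
∑-++ []       ys f = sym (ℤ.+-identityˡ (∑ ys f))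
∑-++ (x ∷ xs) ys f = trans (cong (_+_ (f x)) (∑-++ xs ys f)) (sym (ℤ.+-assoc (f x) _ _))

∑-map : ∀ (g : B → A) xs (f : A → ℤ) → ∑ (map g xs) f ≡ ∑ xs (f ∘ g)
∑-map g xs f = cong sumℤ (sym (List.map-∘ xs))

∑-cong : ∀ {f g : A → ℤ} → (∀ x → f x ≡ g x) → ∀ xs → ∑ xs f ≡ ∑ xs g
∑-cong f≗g xs = cong sumℤ (List.map-cong f≗g xs)

∑-zero : ∀ (xs : List A) → ∑ xs (λ _ → 0ℤ) ≡ 0ℤ
∑-zero []       = refl
∑-zero (x ∷ xs) = trans (ℤ.+-identityˡ _) (∑-zero xs)

∑-*ˡ : ∀ c xs (f : A → ℤ) → ∑ xs (λ x → c * f x) ≡ c * ∑ xs f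
∑-*ˡ c []       f = sym (ℤ.*-zeroʳ c)
∑-*ˡ c (x ∷ xs) f = trans (cong (_+_ (c * f x)) (∑-*ˡ c xs f)) (sym (ℤ.*-distribˡ-+ c (f x) _))

∑-difference : ∀ xs (f g : A → ℤ) → ∑ xs (λ x → f x - g x) ≡ ∑ xs f - ∑ xs g
∑-difference []       f g = refl
∑-difference (x ∷ xs) f g = trans (cong (_+_ (f x - g x)) (∑-difference xs f g))
  (solve 4 (λ a b c d → (a :- b) :+ (c :- d) := (a :+ c) :- (b :+ d)) refl (f x) (g x) (∑ xs f) (∑ xs g))

∑-filter : ∀ (Q : A → Bool) xs f → ∑ (filterᵇ Q xs) f ≡ ∑ xs (λ x → if Q x then f x else 0ℤ)
∑-filter Q []       f = refl
∑-filter Q (x ∷ xs) f with Q x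
... | true  = cong (_+_ (f x)) (∑-filter Q xs f)
... | false = trans (∑-filter Q xs f) (sym (ℤ.+-identityˡ _))

_≟_ : DecidableEquality (Subset n)
_≟_ = Vec.≡-dec Bool._≟_

p⊆q∧p≢q⇒∣p∣<∣q∣ : ∀ {p q : Subset n} → p ⊆ q → p ≢ q → ∣ p ∣ < ∣ q ∣
p⊆q∧p≢q⇒∣p∣<∣q∣ {p = []}          {[]}          _   p≢q = contradiction refl p≢q
p⊆q∧p≢q⇒∣p∣<∣q∣ {p = inside ∷ p}  {inside ∷ q}  p⊆q p≢q =
  s≤s (p⊆q∧p≢q⇒∣p∣<∣q∣ (drop-∷-⊆ p⊆q) (p≢q ∘ cong (inside ∷_)))
p⊆q∧p≢q⇒∣p∣<∣q∣ {p = inside ∷ p}  {outside ∷ q} p⊆q _   with () ← p⊆q here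
p⊆q∧p≢q⇒∣p∣<∣q∣ {p = outside ∷ p} {inside ∷ q}  p⊆q _   = s≤s (p⊆q⇒∣p∣≤∣q∣ (drop-∷-⊆ p⊆q))
p⊆q∧p≢q⇒∣p∣<∣q∣ {p = outside ∷ p} {outside ∷ q} p⊆q p≢q =
  p⊆q∧p≢q⇒∣p∣<∣q∣ (drop-∷-⊆ p⊆q) (p≢q ∘ cong (outside ∷_))

x∈p⇒⁅x⁆⊆p : ∀ {x} {p : Subset n} → x ∈ p → ⁅ x ⁆ ⊆ p
x∈p⇒⁅x⁆⊆p {x = x} {p} x∈p y∈⁅x⁆ = subst (_∈ p) (sym (x∈⁅y⁆⇒x≡y x y∈⁅x⁆)) x∈p

Nonempty⇒∣p∣>0 : ∀ {p : Subset n} → Nonempty p → 0 < ∣ p ∣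
Nonempty⇒∣p∣>0 (x , x∈p) = subst (_≤ _) (∣⁅x⁆∣≡1 x) (p⊆q⇒∣p∣≤∣q∣ (x∈p⇒⁅x⁆⊆p x∈p))

Nonempty[p∩q]⇒p≢⊥ : ∀ {p q : Subset n} → Nonempty (p ∩ q) → p ≢ ⊥
Nonempty[p∩q]⇒p≢⊥ {q = q} (x , x∈p∩q) refl = ∉⊥ (proj₁ (x∈p∩q⁻ ⊥ q x∈p∩q))

p⊆q∧Empty[p∩q]⇒p≡⊥ : ∀ {p q : Subset n} → p ⊆ q → Empty (p ∩ q) → p ≡ ⊥
p⊆q∧Empty[p∩q]⇒p≡⊥ p⊆q p∩q≡∅ = Empty-unique λ (x , x∈p) → p∩q≡∅ (x , x∈p∩q⁺ (x∈p , p⊆q x∈p))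

p⊆q∩r⇔p⊆q×p⊆r : ∀ {p q r : Subset n} → p ⊆ q ∩ r ⇔ (p ⊆ q × p ⊆ r)
p⊆q∩r⇔p⊆q×p⊆r {p = p} {q} {r} = mk⇔ split join
  where
  split : p ⊆ q ∩ r → p ⊆ q × p ⊆ r
  split p⊆q∩r = (λ x∈p → p∩q⊆p q r (p⊆q∩r x∈p)) , (λ x∈p → p∩q⊆q q r (p⊆q∩r x∈p))
  join : p ⊆ q × p ⊆ r → p ⊆ q ∩ r
  join (p⊆q , p⊆r) x∈p = x∈p∩q⁺ (p⊆q x∈p , p⊆r x∈p)

∈-tabulate⇔ : ∀ {f : Fin n → Bool} {e} → e ∈ tabulate f ⇔ f e ≡ true
∈-tabulate⇔ {f = f} {e} = mk⇔
  (λ e∈ → trans (sym (Vec.lookup∘tabulate f e)) (Vec.[]=⇒lookup e∈))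
  (λ fe → Vec.lookup⇒[]= e (tabulate f) (trans (Vec.lookup∘tabulate f e) fe))

length-filterᵇ-tabulate : ∀ (q : A → Bool) (f : Fin n → A) →
  length (filterᵇ q (List.tabulate f)) ≡ ∣ tabulate (q ∘ f) ∣
length-filterᵇ-tabulate {n = zero}  q f = refl
length-filterᵇ-tabulate {n = suc n} q f with q (f Fin.zero)
... | true  = cong suc (length-filterᵇ-tabulate q (f ∘ Fin.suc))
... | false = length-filterᵇ-tabulate q (f ∘ Fin.suc)

∑-allSubsets-suc : ∀ n (f : Subset (suc n) → ℤ) →
  ∑ (allSubsets (suc n)) f ≡ ∑ (allSubsets n) (f ∘ (true ∷_)) + ∑ (allSubsets n) (f ∘ (false ∷_))
∑-allSubsets-suc n f =
  trans (∑-++ (map (true ∷_) Ts) _ f) (cong₂ _+_ (∑-map (true ∷_) Ts f) (∑-map (false ∷_) Ts f))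
  where Ts = allSubsets n

∑-allSubsets-δ : ∀ (S : Subset n) (f : Subset n → ℤ) →
  ∑ (allSubsets n) (λ T → if does (T ≟ S) then f T else 0ℤ) ≡ f S
∑-allSubsets-δ []                  f = ℤ.+-identityʳ (f [])
∑-allSubsets-δ {suc n} (true ∷ S)  f = begin
  ∑ (allSubsets (suc n)) _                          ≡⟨ ∑-allSubsets-suc n _ ⟩
  ∑ (allSubsets n) _ + ∑ (allSubsets n) (λ _ → 0ℤ)  ≡⟨ cong₂ _+_ (∑-allSubsets-δ S (f ∘ (true ∷_))) (∑-zero (allSubsets n)) ⟩
  f (true ∷ S) + 0ℤ                                 ≡⟨ ℤ.+-identityʳ _ ⟩
  f (true ∷ S)                                      ∎
  where open ≡-Reasoning
∑-allSubsets-δ {suc n} (false ∷ S) f = begin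
  ∑ (allSubsets (suc n)) _                          ≡⟨ ∑-allSubsets-suc n _ ⟩
  ∑ (allSubsets n) (λ _ → 0ℤ) + ∑ (allSubsets n) _  ≡⟨ cong₂ _+_ (∑-zero (allSubsets n)) (∑-allSubsets-δ S (f ∘ (false ∷_))) ⟩
  0ℤ + f (false ∷ S)                                ≡⟨ ℤ.+-identityˡ _ ⟩
  f (false ∷ S)                                     ∎
  where open ≡-Reasoning

powerOn : Subset n → ℤ → Subset n → ℤ
powerOn N x T = if does (T ⊆? N) then x ^ ∣ T ∣ else 0ℤ

powerOn-⊥ : ∀ (N : Subset n) x → powerOn N x ⊥ ≡ 1ℤ
powerOn-⊥ {n} N x rewrite dec-true (⊥ ⊆? N) (⊆-min N) | ∣⊥∣≡0 n = refl

powerOn-⊈ : ∀ (N : Subset n) x T → ¬ T ⊆ N → powerOn N x T ≡ 0ℤ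
powerOn-⊈ N x T T⊈N with T ⊆? N
... | yes T⊆N = ⊥-elim (T⊈N T⊆N)
... | no _    = refl

-1^k*[-x]^k≡x^k : ∀ k x → -1ℤ ^ k * (- x) ^ k ≡ x ^ k
-1^k*[-x]^k≡x^k zero    x = refl
-1^k*[-x]^k≡x^k (suc k) x = begin
  (-1ℤ * -1ℤ ^ k) * (- x * (- x) ^ k)
    ≡⟨ solve 3 (λ a b x → (:- con 1ℤ :* a) :* (:- x :* b) := x :* (a :* b)) refl (-1ℤ ^ k) ((- x) ^ k) x ⟩
  x * (-1ℤ ^ k * (- x) ^ k)
    ≡⟨ cong (x *_) (-1^k*[-x]^k≡x^k k x) ⟩
  x * x ^ k
    ∎
  where open ≡-Reasoning

powerOn-alternating : ∀ (N : Subset n) x T → powerOn N -1ℤ T * (- x) ^ ∣ T ∣ ≡ powerOn N x T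
powerOn-alternating N x T with does (T ⊆? N)
... | true  = -1^k*[-x]^k≡x^k ∣ T ∣ x
... | false = ℤ.*-zeroˡ ((- x) ^ ∣ T ∣)

∑-allSubsets-binomial : ∀ (N : Subset n) p → ∑ (allSubsets n) (powerOn N p) ≡ (1ℤ + p) ^ ∣ N ∣
∑-allSubsets-binomial []                  p = refl
∑-allSubsets-binomial {suc n} (true ∷ N)  p = begin
  ∑ (allSubsets (suc n)) _                                            ≡⟨ ∑-allSubsets-suc n _ ⟩
  ∑ Ts (λ T → if does (T ⊆? N) then p * p ^ ∣ T ∣ else 0ℤ) + ∑ Ts N^p  ≡⟨ cong (_+ ∑ Ts N^p) (∑-cong scale Ts) ⟩
  ∑ Ts (λ T → p * N^p T) + ∑ Ts N^p                                    ≡⟨ cong (_+ ∑ Ts N^p) (∑-*ˡ p Ts N^p) ⟩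
  p * ∑ Ts N^p + ∑ Ts N^p                                              ≡⟨ cong (λ x → p * x + x) (∑-allSubsets-binomial N p) ⟩
  p * (1ℤ + p) ^ ∣ N ∣ + (1ℤ + p) ^ ∣ N ∣                               ≡⟨ solve 2 (λ p x → p :* x :+ x := (con 1ℤ :+ p) :* x) refl p _ ⟩
  (1ℤ + p) ^ ∣ true ∷ N ∣                                             ∎
  where
  open ≡-Reasoning
  Ts = allSubsets n
  N^p = powerOn N p
  scale : ∀ T → (if does (T ⊆? N) then p * p ^ ∣ T ∣ else 0ℤ) ≡ p * N^p T
  scale T with does (T ⊆? N)
  ... | true  = refl
  ... | false = sym (ℤ.*-zeroʳ p)
∑-allSubsets-binomial {suc n} (false ∷ N) p = begin
  ∑ (allSubsets (suc n)) _                  ≡⟨ ∑-allSubsets-suc n _ ⟩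
  ∑ Ts (λ _ → 0ℤ) + ∑ Ts (powerOn N p)      ≡⟨ cong (_+ ∑ Ts (powerOn N p)) (∑-zero Ts) ⟩
  0ℤ + ∑ Ts (powerOn N p)                   ≡⟨ ℤ.+-identityˡ _ ⟩
  ∑ Ts (powerOn N p)                        ≡⟨ ∑-allSubsets-binomial N p ⟩
  (1ℤ + p) ^ ∣ N ∣                          ∎
  where
  open ≡-Reasoning
  Ts = allSubsets n

∑-⊆-alternating : ∀ {S N : Subset n} → Nonempty (S ∩ N) →
  ∑ (allSubsets n) (λ T → if does (T ⊆? S) then powerOn N -1ℤ T else 0ℤ) ≡ 0ℤ
∑-⊆-alternating {n} {S} {N} S∩N≢∅ = begin
  ∑ Ts (λ T → if does (T ⊆? S) then powerOn N -1ℤ T else 0ℤ)  ≡⟨ ∑-cong ⊆-∩ Ts ⟩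
  ∑ Ts (powerOn (S ∩ N) -1ℤ)                                 ≡⟨ ∑-allSubsets-binomial (S ∩ N) -1ℤ ⟩
  0ℤ ^ ∣ S ∩ N ∣                                             ≡⟨ 0^positive (Nonempty⇒∣p∣>0 S∩N≢∅) ⟩
  0ℤ                                                         ∎
  where
  open ≡-Reasoning
  Ts = allSubsets n
  ⊆-∩ : ∀ T → (if does (T ⊆? S) then powerOn N -1ℤ T else 0ℤ) ≡ powerOn (S ∩ N) -1ℤ T
  ⊆-∩ T = trans (sym (if-∧ (does (T ⊆? S))))
    (cong (λ b → if b then -1ℤ ^ ∣ T ∣ else 0ℤ)
      (sym (does-⇔ p⊆q∩r⇔p⊆q×p⊆r (T ⊆? S ∩ N) ((T ⊆? S) ×-dec (T ⊆? N)))))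
  0^positive : ∀ {k} → 0 < k → 0ℤ ^ k ≡ 0ℤ
  0^positive {suc k} _ = refl

properSub-split : ∀ (S : Subset n) (f : Subset n → ℤ) T →
  (if properSub T S then f T else 0ℤ) ≡ (if does (T ⊆? S) then f T else 0ℤ) - (if does (T ≟ S) then f T else 0ℤ)
properSub-split S f T with T ⊆? S | T ≟ S
... | no T⊈S | yes refl = ⊥-elim (T⊈S ⊆-refl)
... | no _   | no _     = refl
... | yes _  | yes refl with ∣ S ∣ <ᵇ ∣ S ∣ | ℕ.<ᵇ-reflects-< ∣ S ∣ ∣ S ∣
...   | true  | ofʸ S<S = contradiction S<S (ℕ.n≮n _)
...   | false | _       = sym (ℤ.+-inverseʳ (f S))
properSub-split S f T | yes T⊆S | no T≢S with ∣ T ∣ <ᵇ ∣ S ∣ | ℕ.<ᵇ-reflects-< ∣ T ∣ ∣ S ∣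
...   | true  | _        = sym (ℤ.+-identityʳ (f T))
...   | false | ofⁿ T≮S = contradiction (p⊆q∧p≢q⇒∣p∣<∣q∣ T⊆S T≢S) T≮S

∑-properSub : ∀ (S : Subset n) (f : Subset n → ℤ) →
  ∑ (allSubsets n) (λ T → if properSub T S then f T else 0ℤ)
  ≡ ∑ (allSubsets n) (λ T → if does (T ⊆? S) then f T else 0ℤ) - f S
∑-properSub {n} S f = begin
  ∑ Ts (λ T → if properSub T S then f T else 0ℤ)  ≡⟨ ∑-cong (properSub-split S f) Ts ⟩
  ∑ Ts (λ T → f⊆S T - f≡S T)                      ≡⟨ ∑-difference Ts f⊆S f≡S ⟩
  ∑ Ts f⊆S - ∑ Ts f≡S                             ≡⟨ cong (_-_ (∑ Ts f⊆S)) (∑-allSubsets-δ S f) ⟩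
  ∑ Ts f⊆S - f S                                  ∎
  where
  open ≡-Reasoning
  Ts = allSubsets n
  f⊆S f≡S : Subset n → ℤ
  f⊆S T = if does (T ⊆? S) then f T else 0ℤ
  f≡S T = if does (T ≟ S) then f T else 0ℤ

meets : Subset n → Subset n → Bool
meets T N = does (nonempty? (T ∩ N))

∑-meets : ∀ (N : Subset n) (f : Subset n → ℤ) → (∀ T → ¬ T ⊆ N → f T ≡ 0ℤ) →
  ∑ (allSubsets n) (λ T → if meets T N then f T else 0ℤ) ≡ ∑ (allSubsets n) f - f ⊥
∑-meets {n} N f f-vanishes = begin
  ∑ Ts (λ T → if meets T N then f T else 0ℤ)              ≡⟨ ∑-cong meets-split Ts ⟩
  ∑ Ts (λ T → f T - (if does (T ≟ ⊥) then f T else 0ℤ))  ≡⟨ ∑-difference Ts f _ ⟩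
  ∑ Ts f - ∑ Ts (λ T → if does (T ≟ ⊥) then f T else 0ℤ) ≡⟨ cong (_-_ (∑ Ts f)) (∑-allSubsets-δ ⊥ f) ⟩
  ∑ Ts f - f ⊥                                           ∎
  where
  open ≡-Reasoning
  Ts = allSubsets n
  meets-split : ∀ T → (if meets T N then f T else 0ℤ) ≡ f T - (if does (T ≟ ⊥) then f T else 0ℤ)
  meets-split T with nonempty? (T ∩ N) | T ≟ ⊥
  ... | yes T∩N≢∅ | yes T≡⊥  = contradiction T≡⊥ (Nonempty[p∩q]⇒p≢⊥ T∩N≢∅)
  ... | yes _     | no _     = sym (ℤ.+-identityʳ (f T))
  ... | no _      | yes refl = sym (ℤ.+-inverseʳ (f ⊥))
  ... | no T∩N≡∅  | no T≢⊥   =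
    sym (trans (ℤ.+-identityʳ (f T)) (f-vanishes T (λ T⊆N → T≢⊥ (p⊆q∧Empty[p∩q]⇒p≡⊥ T⊆N T∩N≡∅))))

module _ {m} (M : Matroid m) (i : ℕ) (N : Subset m) (inS≡meets : ∀ T → inS M i T ≡ meets T N) where

  mobiusF-closedForm : ∀ k S → ∣ S ∣ < k → Nonempty (S ∩ N) → mobiusF M i k S ≡ powerOn N -1ℤ S
  mobiusF-closedForm (suc k) S (s≤s ∣S∣≤k) S∩N≢∅ = begin
    - (1ℤ + ∑ (filterᵇ (λ T → inS M i T ∧ properSub T S) Ts) (mobiusF M i k))
      ≡⟨ cong (λ x → - (1ℤ + x)) (trans (∑-filter _ Ts _) (∑-cong recurse Ts)) ⟩
    - (1ℤ + ∑ Ts (λ T → if meets T N then below T else 0ℤ))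
      ≡⟨ cong (λ x → - (1ℤ + x)) (∑-meets N below below-⊈) ⟩
    - (1ℤ + (∑ Ts below - below ⊥))
      ≡⟨ cong₂ (λ x y → - (1ℤ + (x - y))) (∑-properSub S μ) below-⊥ ⟩
    - (1ℤ + ((∑ Ts (λ T → if does (T ⊆? S) then μ T else 0ℤ) - μ S) - 1ℤ))
      ≡⟨ cong (λ x → - (1ℤ + ((x - μ S) - 1ℤ))) (∑-⊆-alternating S∩N≢∅) ⟩
    - (1ℤ + ((0ℤ - μ S) - 1ℤ))
      ≡⟨ solve 1 (λ x → :- (con 1ℤ :+ ((con 0ℤ :- x) :- con 1ℤ)) := x) refl (μ S) ⟩
    μ S
      ∎
    where
    open ≡-Reasoning
    Ts = allSubsets m
    μ below : Subset m → ℤ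
    μ = powerOn N -1ℤ
    below T = if properSub T S then μ T else 0ℤ

    below-⊈ : ∀ T → ¬ T ⊆ N → below T ≡ 0ℤ
    below-⊈ T T⊈N with properSub T S
    ... | true  = powerOn-⊈ N -1ℤ T T⊈N
    ... | false = refl

    below-⊥ : below ⊥ ≡ 1ℤ
    below-⊥ = begin
      below ⊥                                                                   ≡⟨ properSub-split S μ ⊥ ⟩
      (if does (⊥ ⊆? S) then μ ⊥ else 0ℤ) - (if does (⊥ ≟ S) then μ ⊥ else 0ℤ)
        ≡⟨ cong₂ (λ b c → (if b then μ ⊥ else 0ℤ) - (if c then μ ⊥ else 0ℤ))
             (dec-true (⊥ ⊆? S) (⊆-min S)) (dec-false (⊥ ≟ S) (≢-sym (Nonempty[p∩q]⇒p≢⊥ S∩N≢∅))) ⟩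
      μ ⊥ - 0ℤ                                                                  ≡⟨ ℤ.+-identityʳ (μ ⊥) ⟩
      μ ⊥                                                                       ≡⟨ powerOn-⊥ N -1ℤ ⟩
      1ℤ                                                                        ∎

    recurse : ∀ T → (if inS M i T ∧ properSub T S then mobiusF M i k T else 0ℤ)
                    ≡ (if meets T N then below T else 0ℤ)
    recurse T rewrite inS≡meets T with nonempty? (T ∩ N) | T ⊆? S | ∣ T ∣ <ᵇ ∣ S ∣ | ℕ.<ᵇ-reflects-< ∣ T ∣ ∣ S ∣
    ... | no _      | _     | _     | _             = refl
    ... | yes _     | no _  | _     | _             = refl
    ... | yes _     | yes _ | false | _             = refl
    ... | yes T∩N≢∅ | yes _ | true  | ofʸ ∣T∣<∣S∣ =
      mobiusF-closedForm k T (ℕ.≤-trans ∣T∣<∣S∣ ∣S∣≤k) T∩N≢∅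

  mobius-closedForm : ∀ S → Nonempty (S ∩ N) → mobius M i S ≡ powerOn N -1ℤ S
  mobius-closedForm S = mobiusF-closedForm (suc m) S (s≤s (∣p∣≤n S))

  W-closedForm : suc i ≡ rank M → ∀ p → W M i p ≡ (1ℤ + p) ^ ∣ N ∣ - 1ℤ
  W-closedForm 1+i≡d p = begin
    ∑ (filterᵇ (inS M i) Ts) term                         ≡⟨ ∑-filter (inS M i) Ts term ⟩
    ∑ Ts (λ S → if inS M i S then term S else 0ℤ)          ≡⟨ ∑-cong simplify Ts ⟩
    ∑ Ts (λ S → if meets S N then powerOn N p S else 0ℤ)   ≡⟨ ∑-meets N (powerOn N p) (powerOn-⊈ N p) ⟩
    ∑ Ts (powerOn N p) - powerOn N p ⊥                     ≡⟨ cong₂ _-_ (∑-allSubsets-binomial N p) (powerOn-⊥ N p) ⟩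
    (1ℤ + p) ^ ∣ N ∣ - 1ℤ                                  ∎
    where
    open ≡-Reasoning
    Ts = allSubsets m
    term : Subset m → ℤ
    term S = mobius M i S * (- p) ^ ((∣ S ∣ ℕ.+ 1 ℕ.+ i) ∸ rank M)

    exponent : ∀ k → (k ℕ.+ 1 ℕ.+ i) ∸ rank M ≡ k
    exponent k = trans (cong₂ _∸_ (ℕ.+-assoc k 1 i) (sym 1+i≡d)) (ℕ.m+n∸n≡m k (suc i))

    simplify : ∀ S → (if inS M i S then term S else 0ℤ) ≡ (if meets S N then powerOn N p S else 0ℤ)
    simplify S rewrite inS≡meets S with nonempty? (S ∩ N)
    ... | no _      = refl
    ... | yes S∩N≢∅ = trans (cong₂ (λ μ k → μ * (- p) ^ k) (mobius-closedForm S S∩N≢∅) (exponent ∣ S ∣))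
                            (powerOn-alternating N p S)

module _ {m} (M : Matroid m) where

  isLoop : Fin m → Bool
  isLoop e = ρ M ⁅ e ⁆ ℕ.≡ᵇ 0

  loopSet nonLoops : Subset m
  loopSet  = tabulate isLoop
  nonLoops = ∁ loopSet

  ∣nonLoops∣ : ∣ nonLoops ∣ ≡ m ∸ loops M
  ∣nonLoops∣ = trans (∣∁p∣≡n∸∣p∣ loopSet) (cong (m ∸_) (sym (length-filterᵇ-tabulate isLoop (λ e → e))))

  ∈-loopSet⇔ : ∀ {e} → e ∈ loopSet ⇔ ρ M ⁅ e ⁆ ≡ 0
  ∈-loopSet⇔ = mk⇔
    (λ e∈L → ℕ.≡ᵇ⇒≡ _ 0 (Equivalence.from T-≡ (Equivalence.to ∈-tabulate⇔ e∈L)))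
    (λ ρe≡0 → Equivalence.from ∈-tabulate⇔ (Equivalence.to T-≡ (ℕ.≡⇒≡ᵇ _ 0 ρe≡0)))

  ρ-⊥ : ρ M ⊥ ≡ 0
  ρ-⊥ = ℕ.n≤0⇒n≡0 (subst (ρ M ⊥ ≤_) (∣⊥∣≡0 m) (ρ-bound M ⊥))

  ρ-subadditive : ∀ S T → ρ M (S ∪ T) ≤ ρ M S ℕ.+ ρ M T
  ρ-subadditive S T = ℕ.≤-trans (ℕ.m≤m+n _ _) (ρ-submod M S T)

  ρ-loops : ∀ T → (∀ {e} → e ∈ T → ρ M ⁅ e ⁆ ≡ 0) → ρ M T ≡ 0
  ρ-loops T = go T (⊂-wellFounded T)
    where
    go : ∀ T → Acc _⊂_ T → (∀ {e} → e ∈ T → ρ M ⁅ e ⁆ ≡ 0) → ρ M T ≡ 0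
    go T _ loops with nonempty? T
    go T _ loops | no T≡∅ rewrite Empty-unique T≡∅ = ρ-⊥
    go T (acc rec) loops | yes (e , e∈T) = ℕ.n≤0⇒n≡0 (begin
      ρ M T                              ≤⟨ ρ-mono M cover ⟩
      ρ M ((T ─ ⁅ e ⁆) ∪ ⁅ e ⁆)          ≤⟨ ρ-subadditive (T ─ ⁅ e ⁆) ⁅ e ⁆ ⟩
      ρ M (T ─ ⁅ e ⁆) ℕ.+ ρ M ⁅ e ⁆      ≡⟨ cong₂ ℕ._+_ (go (T ─ ⁅ e ⁆) (rec (x∈p⇒p-x⊂p e∈T)) (loops ∘ p─q⊆p T ⁅ e ⁆))
                                                        (loops e∈T) ⟩
      0                                  ∎)
      where
      open ℕ.≤-Reasoning
      cover : T ⊆ (T ─ ⁅ e ⁆) ∪ ⁅ e ⁆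
      cover {x} x∈T with x Fin.≟ e
      ... | yes refl = x∈p∪q⁺ (inj₂ (x∈⁅x⁆ x))
      ... | no x≢e   = x∈p∪q⁺ (inj₁ (x∈p∧x≢y⇒x∈p-y x∈T x≢e))

  0<ρ⇔Nonempty[∩nonLoops] : ∀ T → 0 < ρ M T ⇔ Nonempty (T ∩ nonLoops)
  0<ρ⇔Nonempty[∩nonLoops] T = mk⇔ to from
    where
    to : 0 < ρ M T → Nonempty (T ∩ nonLoops)
    to 0<ρT with nonempty? (T ∩ nonLoops)
    ... | yes T∩N≢∅ = T∩N≢∅
    ... | no  T∩N≡∅ = contradiction (ρ-loops T loop) (ℕ.>⇒≢ 0<ρT)
      where
      loop : ∀ {e} → e ∈ T → ρ M ⁅ e ⁆ ≡ 0
      loop {e} e∈T with e ∈? loopSet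
      ... | yes e∈L = Equivalence.to ∈-loopSet⇔ e∈L
      ... | no  e∉L = ⊥-elim (T∩N≡∅ (e , x∈p∩q⁺ (e∈T , x∉p⇒x∈∁p e∉L)))
    from : Nonempty (T ∩ nonLoops) → 0 < ρ M T
    from (e , e∈T∩N) with x∈p∩q⁻ T nonLoops e∈T∩N
    ... | e∈T , e∈N =
      ℕ.≤-trans (ℕ.n≢0⇒n>0 (x∈∁p⇒x∉p e∈N ∘ Equivalence.from ∈-loopSet⇔)) (ρ-mono M (x∈p⇒⁅x⁆⊆p e∈T))

  inS-rank∸1≡meets-nonLoops : 1 ≤ rank M → ∀ T → inS M (rank M ∸ 1) T ≡ meets T nonLoops
  inS-rank∸1≡meets-nonLoops 1≤d T =
    trans (cong (ℕ._≤ᵇ ρ M T) (ℕ.m∸[m∸n]≡n 1≤d))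
          (does-⇔ (0<ρ⇔Nonempty[∩nonLoops] T) (1 ℕ.≤? ρ M T) (nonempty? (T ∩ nonLoops)))

lemma2p4 : (m : ℕ) (M : Matroid m) → 1 ≤ rank M →
    (p : ℤ) → W M (rank M ∸ 1) p ≡ ((+ 1 + p) ^ (m ∸ loops M)) - + 1
lemma2p4 m M 1≤d p = begin
  W M (rank M ∸ 1) p
    ≡⟨ W-closedForm M (rank M ∸ 1) (nonLoops M) (inS-rank∸1≡meets-nonLoops M 1≤d) (ℕ.m+[n∸m]≡n 1≤d) p ⟩
  (1ℤ + p) ^ ∣ nonLoops M ∣ - 1ℤ
    ≡⟨ cong (λ k → (1ℤ + p) ^ k - 1ℤ) (∣nonLoops∣ M) ⟩
  (1ℤ + p) ^ (m ∸ loops M) - 1ℤ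
    ∎
  where open ≡-Reasoning
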